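{- Let $\mathcal{E}=(E,\leq,\sharp,l)$ be a labelled prime event structure, $C$ a configuration of $\mathcal{E}$, and $e,e'\in E$. If $\emptyset\triangleright\textsc{espsi}(\mathcal{E},C)\xrightarrow{\overline{e}e}P_1$, $\emptyset\triangleright P_1\xrightarrow{\overline{e'}e'}P_2$, $\emptyset\triangleright\textsc{espsi}(\mathcal{E},C)\xrightarrow{\overline{e'}e'}P_3$ and $\emptyset\triangleright P_3\xrightarrow{\overline{e}e}P_4$ with $P_2=P_4$, then $e$ and $e'$ are concurrent in $\mathcal{E}$, i.e. $\neg(e\leq e'\vee e'\leq e\vee e\sharp e')$.
   Context: A labelled prime event structure is $\mathcal{E}=(E,\leq,\sharp,l)$ with $E$ a (possibly infinite) set of events, $\leq$ a partial order such that $\{d\mid d\leq e\}$ is finite for every $e$, $\sharp$ an irreflexive symmetric relation such that $d\leq e$ and $d\sharp f$ imply $e\sharp f$, and $l$ a labelling. A configuration is a finite conflict-free, downward closed subset of $E$. Write $\lfloor e\rfloor=\{e'\in E\mid e'\leq e,\ e'\neq e\}$ and $\sharp e=\{e'\mid e'\sharp e\}$. The psi-calculus instance \textsf{eventPsi} over $E$: terms are elements of $E$; assertions are subsets of $E$; conditions are pairs $(A,B)$ of subsets of $E$ (plus channel-equality conditions $a\leftrightarrow b$); composition of assertions is union, unit $\emptyset$; $\Psi\vdash(A,B)$ iff $A\subseteq\Psi$ and $\Psi\cap B=\emptyset$; $\Psi\vdash a\leftrightarrow b$ iff $a=b$. Frames: $\mathcal{F}((\!|\Psi|\!))=\Psi$,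 $\mathcal{F}(P\mid Q)=\mathcal{F}(P)\cup\mathcal{F}(Q)$, and frames of case/output/input/replicated processes are $\emptyset$. Transitions $\Psi\triangleright P\xrightarrow{\alpha}P'$ are given by the psi-calculus rules, in particular: (Out) if $\Psi\vdash M\leftrightarrow K$ then $\Psi\triangleright\overline{M}N.P\xrightarrow{\overline{K}N}P$; (Case) if $\Psi\triangleright P_i\xrightarrow{\alpha}P'$ and $\Psi\vdash\varphi_i$ then $\Psi\triangleright\mathbf{case}\ \varphi_1:P_1,\dots\xrightarrow{\alpha}P'$; (Par) if $\Psi\cup\mathcal{F}(Q)\triangleright P\xrightarrow{\alpha}P'$ then $\Psi\triangleright P\mid Q\xrightarrow{\alpha}P'\mid Q$ (and symmetrically); assertion processes have no transitions. Parallel compositions are taken up to associativity and commutativity. $\textsc{espsi}(\mathcal{E},C)=\mid_{e\in E}P_e$ where $P_e=(\!|\{e\}|\!)$ if $e\in C$ and otherwise $P_e=\mathbf{case}\ (\lfloor e\rfloor,\sharp e):\overline{e}e.(\!|\{e\}|\!)$. -}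

module Defs where

open import Level using (0ℓ)
open import Data.Product using (Σ; ∃; _×_; _,_)
open import Data.Sum using (_⊎_)
open import Data.Empty using (⊥)
open import Data.List using (List; []; _∷_)
open import Data.List.Membership.Propositional using (_∈_)
open import Relation.Nullary using (¬_)
open import Relation.Binary.PropositionalEquality using (_≡_; _≢_)
open import Relation.Binary.Structures using (IsPartialOrder)
open import Function.Bundles using (_↔_; Inverse)

record EventStructure : Set₁ where
  field
    E       : Set
    _≤_     : E → E → Set
    _♯_     : E → E → Set
    Label   : Set
    l       : E → Label
    ≤-po    : IsPartialOrder _≡_ _≤_
    ≤-finite : ∀ e → ∃ λ (ds : List E) → ∀ d → d ≤ e → d ∈ ds
    ♯-irrefl : ∀ e → ¬ (e ♯ e)
    ♯-sym    : ∀ {d e} → d ♯ e → e ♯ d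
    ♯-inh    : ∀ {d e f} → d ≤ e → d ♯ f → e ♯ f

module _ (ES : EventStructure) where
  open EventStructure ES

  Pred : Set₁
  Pred = E → Set

  Finite : Pred → Set
  Finite S = ∃ λ (xs : List E) → ∀ x → S x → x ∈ xs

  record IsConfiguration (C : Pred) : Set where
    field
      finite       : Finite C
      conflictFree : ∀ {d e} → C d → C e → ¬ (d ♯ e)
      downClosed   : ∀ {d e} → d ≤ e → C e → C d

  Concurrent : E → E → Set
  Concurrent e e' = ¬ ((e ≤ e') ⊎ (e' ≤ e) ⊎ (e ♯ e'))

  ⌊_⌋ : E → Pred
  ⌊ e ⌋ d = (d ≤ e) × (d ≢ e)

  ♯[_] : E → Pred
  ♯[ e ] d = d ♯ e

  ｛_｝ : E → Pred
  ｛ e ｝ d = d ≡ e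

  _∪_ : Pred → Pred → Pred
  (A ∪ B) x = A x ⊎ B x

  ∅ : Pred
  ∅ _ = ⊥

  data Cond : Set₁ where
    pair : Pred → Pred → Cond
    chan : E → E → Cond

  _⊢_ : Pred → Cond → Set
  Ψ ⊢ pair A B = (∀ x → A x → Ψ x) × (∀ x → Ψ x → B x → ⊥)
  Ψ ⊢ chan a b = a ≡ b

  -- sequential (non-parallel) processes of the fragment used by espsi
  data Comp : Set₁ where
    assert : Pred → Comp
    out    : E → E → Comp → Comp
    case   : List (Cond × Comp) → Comp

  𝓕 : Comp → Pred
  𝓕 (assert Ψ) = Ψ
  𝓕 (out _ _ _) = ∅
  𝓕 (case _) = ∅

  data Act : Set where
    outAct : E → E → Act

  data _▷_─⟨_⟩→_ (Ψ : Pred) : Comp → Act → Comp → Set₁ where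
    Out  : ∀ {M K N P} → Ψ ⊢ chan M K → Ψ ▷ out M N P ─⟨ outAct K N ⟩→ P
    Case : ∀ {cs φ P α P'} → (φ , P) ∈ cs → Ψ ⊢ φ → Ψ ▷ P ─⟨ α ⟩→ P'
         → Ψ ▷ case cs ─⟨ α ⟩→ P'

  data _≈_ : Comp → Comp → Set₁
  data _≈L_ : List (Cond × Comp) → List (Cond × Comp) → Set₁
  data _≈C_ : Cond → Cond → Set₁ where
    pair : ∀ {A A' B B'} → (∀ x → (A x → A' x) × (A' x → A x))
         → (∀ x → (B x → B' x) × (B' x → B x)) → pair A B ≈C pair A' B'
    chan : ∀ {a b} → chan a b ≈C chan a b
  data _≈_ where
    assert : ∀ {Ψ Ψ'} → (∀ x → (Ψ x → Ψ' x) × (Ψ' x → Ψ x)) → assert Ψ ≈ assert Ψ'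
    out    : ∀ {M N P P'} → P ≈ P' → out M N P ≈ out M N P'
    case   : ∀ {cs cs'} → cs ≈L cs' → case cs ≈ case cs'
  data _≈L_ where
    nil  : [] ≈L []
    cons : ∀ {φ φ' P P' cs cs'} → (φ ≈C φ') × (P ≈ P') → cs ≈L cs'
        → ((φ , P) ∷ cs) ≈L ((φ' , P') ∷ cs')

  -- processes: parallel compositions of components indexed by E
  -- (taken up to associativity and commutativity, see _≃_)
  Proc : Set₁
  Proc = E → Comp

  -- equality up to associativity/commutativity of |: a re-indexing
  -- bijection of components, matching components structurally
  _≃_ : Proc → Proc → Set₁
  P ≃ Q = Σ (E ↔ E) λ π → ∀ x → P (Inverse.to π x) ≈ Q x

  𝓕-except : Proc → E → Pred
  𝓕-except P x z = ∃ λ y → (y ≢ x) × 𝓕 (P y) z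

  -- transitions of parallel compositions (iterated rule (Par)): some
  -- component x moves in the environment extended by the frames of all
  -- other components; the others are unchanged; result up to AC.
  _▷ₚ_─⟨_⟩→_ : Pred → Proc → Act → Proc → Set₁
  Ψ ▷ₚ P ─⟨ α ⟩→ P' =
    ∃ λ x → ∃ λ c' →
      ((Ψ ∪ 𝓕-except P x) ▷ P x ─⟨ α ⟩→ c')
      × Σ (E ↔ E) (λ π → (P' (Inverse.to π x) ≈ c')
                        × (∀ y → y ≢ x → P' (Inverse.to π y) ≈ P y))

  IsEspsi : Pred → Proc → Set₁
  IsEspsi C P = ∀ e →
      (C e → P e ≈ assert ｛ e ｝)
    × (¬ C e → P e ≈ case ((pair ⌊ e ⌋ ♯[ e ] , out e e (assert ｛ e ｝)) ∷ []))

module Submission where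

-- In espsi(ℰ, C) the only components able to move are the guarded
-- components  case (⌊e⌋ , ♯e) : ‾e e . (|{e}|)  of events e ∉ C, and an
-- assertion component only ever asserts events of C.  Hence a first step
-- ‾a a from espsi(ℰ, C) fires an event a ∉ C, all of whose strict causes
-- lie in C, and leaves a residual in which a is asserted while every other
-- component is untouched (first-step).  A second step ‾b b from that
-- residual must fire some other pending event b ≠ a, whose guard forbids
-- the asserted a to be in conflict with b (second-step).
--
-- The
-- theorem follows from the transitions e·e' and e'·e: causality in either
-- direction contradicts first-step, conflict contradicts second-step.

open import Data.Product using (_×_; _,_; proj₁; proj₂; ∃)
open import Data.Sum using (inj₁; inj₂)
open import Data.List using (List; []; _∷_)
open import Data.List.Relation.Unary.Any using (here; there)
open import Data.List.Membership.Propositional using (_∈_)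
open import Relation.Nullary using (¬_)
open import Relation.Binary.PropositionalEquality using (_≡_; refl; sym; subst; _≢_)
open import Function.Bundles using (_↔_; Inverse; Injection)
open import Function.Properties.Inverse using (↔⇒↣)
open import Defs using (EventStructure; Cond; pair; chan; assert; out; case; cons; Act; outAct)
import Defs as D

module EspsiSteps (ES : EventStructure) where
  open EventStructure ES
  open Inverse using (to; from)

  Pred : Set₁
  Pred = D.Pred ES
  Proc : Set₁
  Proc = D.Proc ES
  Comp : Set₁
  Comp = D.Comp ES
  ∅ : Pred
  ∅ = D.∅ ES
  _∪_ : Pred → Pred → Pred
  _∪_ = D._∪_ ES
  ⌊_⌋ ♯[_] ｛_｝ : E → Pred
  ⌊_⌋ = D.⌊_⌋ ES
  ♯[_] = D.♯[_] ES
  ｛_｝ = D.｛_｝ ES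
  𝓕 : Comp → Pred
  𝓕 = D.𝓕 ES
  𝓕-except : Proc → E → Pred
  𝓕-except = D.𝓕-except ES
  _⊢_ : Pred → Cond ES → Set
  _⊢_ = D._⊢_ ES
  _≈_ : Comp → Comp → Set₁
  _≈_ = D._≈_ ES
  _≈L_ : List (Cond ES × Comp) → List (Cond ES × Comp) → Set₁
  _≈L_ = D._≈L_ ES
  _≈C_ : Cond ES → Cond ES → Set₁
  _≈C_ = D._≈C_ ES
  _▷_─⟨_⟩→_ : Pred → Comp → Act ES → Comp → Set₁
  _▷_─⟨_⟩→_ = D._▷_─⟨_⟩→_ ES
  _▷ₚ_─⟨_⟩→_ : Pred → Proc → Act ES → Proc → Set₁
  _▷ₚ_─⟨_⟩→_ = D._▷ₚ_─⟨_⟩→_ ES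

  ≈-frame→ : ∀ {c d x} → c ≈ d → 𝓕 c x → 𝓕 d x
  ≈-frame→ {x = x} (assert Ψ≡Ψ') f = proj₁ (Ψ≡Ψ' x) f

  ≈-frame← : ∀ {c d x} → c ≈ d → 𝓕 d x → 𝓕 c x
  ≈-frame← {x = x} (assert Ψ≡Ψ') f = proj₂ (Ψ≡Ψ' x) f

  ≈C-entails : ∀ {Ψ φ φ'} → φ ≈C φ' → Ψ ⊢ φ → Ψ ⊢ φ'
  ≈C-entails (pair A≡A' B≡B') (A⊆Ψ , Ψ∩B=∅) =
      (λ x a' → A⊆Ψ x (proj₂ (A≡A' x) a'))
    , (λ x ψ b' → Ψ∩B=∅ x ψ (proj₂ (B≡B' x) b'))
  ≈C-entails chan a≡b = a≡b

  ≈L-branch : ∀ {cs cs' φ P} → cs ≈L cs' → (φ , P) ∈ cs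
            → ∃ λ φ' → ∃ λ P' → ((φ' , P') ∈ cs') × (φ ≈C φ') × (P ≈ P')
  ≈L-branch (cons (φ≈ , P≈) _) (here refl) = _ , _ , here refl , φ≈ , P≈
  ≈L-branch (cons _ rest) (there m) with ≈L-branch rest m
  ... | φ' , P' , m' , φ≈ , P≈ = φ' , P' , there m' , φ≈ , P≈

  ≈-simulation : ∀ {Ψ c d α c'} → c ≈ d → Ψ ▷ c ─⟨ α ⟩→ c'
               → ∃ λ d' → (Ψ ▷ d ─⟨ α ⟩→ d') × (c' ≈ d')
  ≈-simulation (out P≈) (D.Out eq) = _ , D.Out eq , P≈
  ≈-simulation (case cs≈) (D.Case m ent t) with ≈L-branch cs≈ m
  ... | φ' , P' , m' , φ≈ , P≈ with ≈-simulation P≈ t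
  ... | d' , t' , c'≈d' = d' , D.Case m' (≈C-entails φ≈ ent) t' , c'≈d'

  assert-inert : ∀ {Ψ Φ α c'} → ¬ (Ψ ▷ assert Φ ─⟨ α ⟩→ c')
  assert-inert ()

  moving-frame-empty : ∀ {Ψ c α c' z} → Ψ ▷ c ─⟨ α ⟩→ c' → ¬ 𝓕 c z
  moving-frame-empty {c = assert _} t _ = assert-inert t

  pending : E → Comp
  pending e = case ((pair ⌊ e ⌋ ♯[ e ] , out e e (assert ｛ e ｝)) ∷ [])

  pending-move : ∀ {Ψ e a b c'} → Ψ ▷ pending e ─⟨ outAct a b ⟩→ c'
               → (a ≡ e) × (b ≡ e) × (Ψ ⊢ pair ⌊ e ⌋ ♯[ e ]) × (c' ≡ assert ｛ e ｝)
  pending-move (D.Case (here refl) ent (D.Out refl)) = refl , refl , ent , refl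

  module _ (C : Pred) (P₀ : Proc) (espsi : D.IsEspsi ES C P₀) where

    -- Only components of events y ∉ C move (the others are assertions).
    moving-not-in-C : ∀ {Ψ y α c'} → Ψ ▷ P₀ y ─⟨ α ⟩→ c' → ¬ C y
    moving-not-in-C {y = y} t y∈C = assert-inert (proj₁ (proj₂ (≈-simulation (proj₁ (espsi y) y∈C) t)))

    espsi-move : ∀ {Ψ y a b c'} → Ψ ▷ P₀ y ─⟨ outAct a b ⟩→ c'
               → ¬ C y × (a ≡ y) × (b ≡ y) × (Ψ ⊢ pair ⌊ y ⌋ ♯[ y ]) × 𝓕 c' y
    espsi-move {y = y} t with ≈-simulation (proj₂ (espsi y) (moving-not-in-C t)) t
    ... | _ , t' , c'≈ with pending-move t'
    ... | refl , refl , guard , refl = moving-not-in-C t , refl , refl , guard , ≈-frame← c'≈ refl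

    -- Frames of espsi(ℰ, C) only contain events of C; membership in C is
    -- not assumed decidable, so this holds up to double negation.
    espsi-frame : ∀ {z d} → 𝓕 (P₀ z) d → ¬ ¬ C d
    espsi-frame {z} f d∉C = ¬¬z∈C λ z∈C →
      d∉C (subst C (sym (≈-frame→ (proj₁ (espsi z) z∈C) f)) z∈C)
      where
        ¬¬z∈C : ¬ ¬ C z
        ¬¬z∈C z∉C = ≈-frame→ (proj₂ (espsi z) z∉C) f

    espsi-environment : ∀ {x d} → (∅ ∪ 𝓕-except P₀ x) d → ¬ ¬ C d
    espsi-environment (inj₂ (_ , _ , f)) = espsi-frame f

    record Fired (P₁ : Proc) (a : E) : Set₁ where
      field
        π         : E ↔ E
        asserts-a : 𝓕 (P₁ (to π a)) a
        unchanged : ∀ y → y ≢ a → P₁ (to π y) ≈ P₀ y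

    record FirstStep (a : E) (P₁ : Proc) : Set₁ where
      field
        not-in-C    : ¬ C a
        causes-in-C : ∀ d → ⌊ a ⌋ d → ¬ ¬ C d
        residual    : Fired P₁ a

    first-step : ∀ {a P₁} → ∅ ▷ₚ P₀ ─⟨ outAct a a ⟩→ P₁ → FirstStep a P₁
    first-step (x , c' , t , π , moved≈c' , rest) with espsi-move t
    ... | x∉C , refl , _ , (causes⊆env , _) , asserts-x = record
      { not-in-C    = x∉C
      ; causes-in-C = λ d d<x → espsi-environment (causes⊆env d d<x)
      ; residual    = record { π = π ; asserts-a = ≈-frame← moved≈c' asserts-x ; unchanged = rest }
      }

    second-step : ∀ {a b P₁ P₂} → Fired P₁ a → ∅ ▷ₚ P₁ ─⟨ outAct b b ⟩→ P₂
                → (b ≢ a) × ¬ (a ♯ b)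
    second-step {a} {b} {P₁} fired (x , c' , t , _) =
      from-component (from π x)
        (subst (λ z → (∅ ∪ 𝓕-except P₁ z) ▷ P₁ z ─⟨ outAct b b ⟩→ c')
               (sym (Inverse.strictlyInverseˡ π x)) t)
      where
        open Fired fired
        a-in-env : ∀ {y} → y ≢ a → (∅ ∪ 𝓕-except P₁ (to π y)) a
        a-in-env y≢a = inj₂ (to π a , (λ eq → y≢a (sym (Injection.injective (↔⇒↣ π) eq))) , asserts-a)

        moved-not-a : ∀ {y} → (∅ ∪ 𝓕-except P₁ (to π y)) ▷ P₁ (to π y) ─⟨ outAct b b ⟩→ c' → y ≢ a
        moved-not-a t' refl = moving-frame-empty t' asserts-a

        -- Every moving component is P₁ (π y) for some y; it then behaves as P₀ y.
        from-component : ∀ y → (∅ ∪ 𝓕-except P₁ (to π y)) ▷ P₁ (to π y) ─⟨ outAct b b ⟩→ c'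
                       → (b ≢ a) × ¬ (a ♯ b)
        from-component y t' with ≈-simulation (unchanged y (moved-not-a t')) t'
        ... | _ , t₀ , _ with espsi-move t₀
        ... | _ , refl , _ , (_ , env∩♯b=∅) , _ =
          moved-not-a t' , λ a♯b → env∩♯b=∅ a (a-in-env (moved-not-a t')) a♯b

open import Defs
open EventStructure

theorem12 : (ES : EventStructure) (C : Pred ES) → IsConfiguration ES C
    → (P₀ : Proc ES) → IsEspsi ES C P₀
    → (e e' : E ES) (P₁ P₂ P₃ P₄ : Proc ES)
    → _▷ₚ_─⟨_⟩→_ ES (∅ ES) P₀ (outAct e e) P₁
    → _▷ₚ_─⟨_⟩→_ ES (∅ ES) P₁ (outAct e' e') P₂
    → _▷ₚ_─⟨_⟩→_ ES (∅ ES) P₀ (outAct e' e') P₃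
    → _▷ₚ_─⟨_⟩→_ ES (∅ ES) P₃ (outAct e e) P₄
    → _≃_ ES P₂ P₄
    → Concurrent ES e e'
theorem12 ES C _ P₀ espsi e e' P₁ P₂ P₃ P₄ e-first e'-second e'-first _ _ = concurrent
  where
    open EspsiSteps ES using (first-step; second-step; FirstStep)
    open FirstStep
    fire-e : FirstStep C P₀ espsi e P₁
    fire-e = first-step C P₀ espsi e-first
    fire-e' : FirstStep C P₀ espsi e' P₃
    fire-e' = first-step C P₀ espsi e'-first
    e'-after-e : (e' ≢ e) × ¬ (_♯_ ES e e')
    e'-after-e = second-step C P₀ espsi {P₂ = P₂} (residual fire-e) e'-second
    e'≢e : e' ≢ e
    e'≢e = proj₁ e'-after-e
    concurrent : Concurrent ES e e'
    concurrent (inj₁ e≤e') = causes-in-C fire-e' e (e≤e' , λ e≡e' → e'≢e (sym e≡e')) (not-in-C fire-e)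
    concurrent (inj₂ (inj₁ e'≤e)) = causes-in-C fire-e e' (e'≤e , e'≢e) (not-in-C fire-e')
    concurrent (inj₂ (inj₂ e♯e')) = proj₂ e'-after-e e♯e'
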